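{- Let $m$ be a positive integer such that $9m-4$ is prime and $m$ is not a sum of two squares. Then the number of minimal triples for $m$ is divisible by $3$.
   Context: An $m$-Markoff triple is a triple $(a,b,c)$ of positive integers with $a^2+b^2+c^2=3abc+m$. A minimal triple is an $m$-Markoff triple $(a,b,c)$ with $a\le b\le c$ and $3ab-c\le 0$. -}

module Defs where

open import Data.Nat using (ℕ; _+_; _*_; _≤_)
open import Data.Product using (_×_; _,_; Σ)
open import Relation.Binary.PropositionalEquality using (_≡_)

MarkoffTriple : ℕ → ℕ → ℕ → ℕ → Set
MarkoffTriple m a b c =
  (1 ≤ a) × (1 ≤ b) × (1 ≤ c) × (a * a + b * b + c * c ≡ 3 * a * b * c + m)

-- minimal triple: a ≤ b ≤ c and 3ab - c ≤ 0 (i.e. 3ab ≤ c)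
MinimalTriple : ℕ → ℕ × ℕ × ℕ → Set
MinimalTriple m (a , b , c) =
  MarkoffTriple m a b c × (a ≤ b) × (b ≤ c) × (3 * a * b ≤ c)

SumOfTwoSquares : ℕ → Set
SumOfTwoSquares m = Σ ℕ λ x → Σ ℕ λ y → x * x + y * y ≡ m

{-# OPTIONS --safe #-}
-- Writing c = k + 3ab, the Markoff equation a² + b² + c² = 3abc + m becomes
-- a² + b² + k² + 3abk = m, a form symmetric in (a, b, k).  So every minimal
-- triple is obtained from a representation of m by this form by choosing
-- which of its three entries plays the role of k.  When m is not a sum of two
-- squares no entry vanishes, and when 9m − 4 is prime no two entries agree:
-- 9(2x² + z² + 3x²z) − 4 = (3z + 2)(3z − 2 + 9x²).  Hence each relevant
-- representation has three distinct positive entries and yields exactly three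
-- minimal triples, and distinct choices give distinct triples.
module Submission where

open import Defs
open import Data.Nat using (ℕ; _+_; _*_; _∸_; _≤_)
open import Data.Nat.Primality using (Prime)
open import Data.Nat.Divisibility using (_∣_)
open import Data.Product using (_×_; Σ)
open import Data.List using (List; length)
open import Data.List.Membership.Propositional using (_∈_)
open import Data.List.Relation.Unary.Unique.Propositional using (Unique)
open import Relation.Nullary using (¬_)
open import Function.Bundles using (_⇔_)

open import Data.Bool using (if_then_else_)
open import Data.Empty using (⊥-elim)
open import Data.List using ([]; _∷_; _++_; map; filter; upTo; cartesianProduct)
open import Data.List.Properties using (length-map; length-++; map-∘; map-id-local)
open import Data.List.Membership.Propositional.Properties
  using (∈-map⁺; ∈-map⁻; ∈-filter⁺; ∈-filter⁻; ∈-cartesianProduct⁺; ∈-cartesianProduct⁻; ∈-upTo⁺)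
open import Data.List.Relation.Unary.All as All using (All; []; _∷_)
open import Data.List.Relation.Unary.AllPairs using ([]; _∷_)
open import Data.List.Relation.Unary.Any using (here; there)
import Data.List.Relation.Unary.Unique.Propositional.Properties as Unique
open import Data.Nat using (zero; suc; _<_; s≤s; z≤n; _<?_; _≤?_; _≟_)
open import Data.Nat.Divisibility using (divides; m∣m*n)
open import Data.Nat.Primality using (composite; composite⇒¬prime)
open import Data.Nat.Properties
open import Data.Nat.Tactic.RingSolver using (solve-∀)
open import Data.Product using (_,_; proj₁; proj₂)
open import Function.Bundles using (mk⇔; Equivalence)
open import Relation.Binary using (tri<; tri≈; tri>)
open import Relation.Binary.PropositionalEquality
open import Relation.Nullary using (Dec; does)
open import Relation.Nullary.Decidable using (_×-dec_; dec-true; dec-false)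

length-cartesianProduct : ∀ {a b} {A : Set a} {B : Set b} (xs : List A) (ys : List B) →
  length (cartesianProduct xs ys) ≡ length xs * length ys
length-cartesianProduct [] ys = refl
length-cartesianProduct (x ∷ xs) ys = begin
  length (map (x ,_) ys ++ cartesianProduct xs ys)   ≡⟨ length-++ (map (x ,_) ys) ⟩
  length (map (x ,_) ys) + length (cartesianProduct xs ys)
    ≡⟨ cong₂ _+_ (length-map (x ,_) ys) (length-cartesianProduct xs ys) ⟩
  length ys + length xs * length ys                  ∎
  where open ≡-Reasoning

unique-map-retraction : ∀ {a b} {A : Set a} {B : Set b} {f : A → B} (g : B → A) {xs : List A} →
  All (λ x → g (f x) ≡ x) xs → Unique xs → Unique (map f xs)
unique-map-retraction {f = f} g {xs} gf≡id xs! = Unique.map⁻ (subst Unique xs≡gfxs xs!)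
  where
  xs≡gfxs : xs ≡ map g (map f xs)
  xs≡gfxs = trans (sym (map-id-local gf≡id)) (map-∘ xs)

n≤n*n : ∀ n → n ≤ n * n
n≤n*n zero = z≤n
n≤n*n n@(suc _) = m≤m*n n n

Triple : Set
Triple = ℕ × ℕ × ℕ

markoff⁺ : ℕ → ℕ → ℕ → ℕ
markoff⁺ x y z = x * x + y * y + z * z + 3 * x * y * z
-- Inlined so that solve-∀ sees the polynomial.
{-# INLINE markoff⁺ #-}

markoff⁺-rotate : ∀ x y z → markoff⁺ x y z ≡ markoff⁺ y z x
markoff⁺-rotate = solve-∀

markoff⁺-swap : ∀ x y z → markoff⁺ x y z ≡ markoff⁺ x z y
markoff⁺-swap = solve-∀

n≤markoff⁺ : ∀ x y z → x ≤ markoff⁺ x y z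
n≤markoff⁺ x y z = ≤-trans (n≤n*n x) (≤-trans (m≤m+n _ _) (≤-trans (m≤m+n _ _) (m≤m+n _ _)))

markoff⁺-shift : ∀ a b k → let c = k + 3 * a * b in
  a * a + b * b + c * c ≡ markoff⁺ a b k + 3 * a * b * c
markoff⁺-shift = solve-∀

markoff⁺⇔markoff : ∀ m a b k → let c = k + 3 * a * b in
  (markoff⁺ a b k ≡ m) ⇔ (a * a + b * b + c * c ≡ 3 * a * b * c + m)
markoff⁺⇔markoff m a b k = mk⇔
  (λ eq → trans (markoff⁺-shift a b k) (trans (cong (_+ 3ab * c) eq) (+-comm m _)))
  (λ eq → +-cancelʳ-≡ (3ab * c) _ m (trans (sym (markoff⁺-shift a b k)) (trans eq (+-comm _ m))))
  where
  3ab = 3 * a * b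
  c = k + 3ab

markoff⁺-zero : ∀ a b → markoff⁺ a b 0 ≡ a * a + b * b
markoff⁺-zero = solve-∀

markoff⁺-zero-≢ : ∀ {m a b z} → ¬ SumOfTwoSquares m → z ≡ 0 → markoff⁺ a b z ≢ m
markoff⁺-zero-≢ {a = a} {b} ¬sos refl eq = ¬sos (a , b , trans (sym (markoff⁺-zero a b)) eq)

markoff⁺-repeated-factor : ∀ x z → 9 * markoff⁺ x x (suc z) ≡ 4 + (5 + 3 * z) * (1 + 3 * z + 9 * x * x)
markoff⁺-repeated-factor = solve-∀

¬prime-markoff⁺-repeated : ∀ x z → 1 ≤ x → 1 ≤ z → ¬ Prime (9 * markoff⁺ x x z ∸ 4)
¬prime-markoff⁺-repeated x (suc z) 1≤x _ p =
  composite⇒¬prime (composite d<dq (m∣m*n q)) (subst Prime 9M∸4≡dq p)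
  where
  d = 5 + 3 * z
  q = 1 + 3 * z + 9 * x * x
  9M∸4≡dq : 9 * markoff⁺ x x (suc z) ∸ 4 ≡ d * q
  9M∸4≡dq = trans (cong (_∸ 4) (markoff⁺-repeated-factor x z)) (m+n∸m≡n 4 (d * q))
  d<dq : d < d * q
  d<dq = m<m*n d q (s≤s (≤-trans (*-mono-≤ (*-mono-≤ {1} {9} (s≤s z≤n) 1≤x) 1≤x) (m≤n+m _ (3 * z))))

markoff⁺-repeated-≢ : ∀ {m x y z} → Prime (9 * m ∸ 4) → 1 ≤ x → 1 ≤ z → x ≡ y → markoff⁺ x y z ≢ m
markoff⁺-repeated-≢ {x = x} {z = z} p 1≤x 1≤z refl refl = ¬prime-markoff⁺-repeated x z 1≤x 1≤z p

Ascending : Triple → Set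
Ascending (x , y , z) = 1 ≤ x × x < y × y < z

ReducedSolution : ℕ → Triple → Set
ReducedSolution m (x , y , z) = Ascending (x , y , z) × markoff⁺ x y z ≡ m

reducedSolution? : ∀ m t → Dec (ReducedSolution m t)
reducedSolution? m (x , y , z) = (1 ≤? x ×-dec x <? y ×-dec y <? z) ×-dec markoff⁺ x y z ≟ m

data Position : Set where
  first second third : Position

positions : List Position
positions = first ∷ second ∷ third ∷ []

∈-positions : ∀ p → p ∈ positions
∈-positions first = here refl
∈-positions second = there (here refl)
∈-positions third = there (there (here refl))

positions-unique : Unique positions
positions-unique = ((λ ()) ∷ (λ ()) ∷ []) ∷ ((λ ()) ∷ []) ∷ [] ∷ []

lift : Triple × Position → Triple
lift ((x , y , z) , first) = (y , z , x + 3 * y * z)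
lift ((x , y , z) , second) = (x , z , y + 3 * x * z)
lift ((x , y , z) , third) = (x , y , z + 3 * x * y)

descend : Triple → Triple × Position
descend (a , b , c) = insert (c ∸ 3 * a * b)
  where
  insert : ℕ → Triple × Position
  insert k = if does (b <? k) then ((a , b , k) , third)
             else (if does (a <? k) then ((a , k , b) , second) else ((k , a , b) , first))

descend-lift : ∀ t p → Ascending t → descend (lift (t , p)) ≡ (t , p)
descend-lift (x , y , z) first (_ , x<y , y<z)
  rewrite m+n∸n≡m x (3 * y * z) | dec-false (z <? x) (<-asym (<-trans x<y y<z))
        | dec-false (y <? x) (<-asym x<y) = refl
descend-lift (x , y , z) second (_ , x<y , y<z)
  rewrite m+n∸n≡m y (3 * x * z) | dec-false (z <? y) (<-asym y<z) | dec-true (x <? y) x<y = refl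
descend-lift (x , y , z) third (_ , x<y , y<z)
  rewrite m+n∸n≡m z (3 * x * y) | dec-true (y <? z) y<z = refl

minimal-shift : ∀ {m a b k} → 1 ≤ a → a ≤ b → markoff⁺ a b k ≡ m →
  MinimalTriple m (a , b , k + 3 * a * b)
minimal-shift {m} {a} {b} {k} 1≤a a≤b eq =
  (1≤a , 1≤b , ≤-trans 1≤3ab 3ab≤c , Equivalence.to (markoff⁺⇔markoff m a b k) eq)
  , a≤b , ≤-trans b≤3ab 3ab≤c , 3ab≤c
  where
  1≤b = ≤-trans 1≤a a≤b
  3ab≤c = m≤n+m (3 * a * b) k
  b≤3ab : b ≤ 3 * a * b
  b≤3ab = subst (_≤ 3 * a * b) (*-identityˡ b) (*-monoˡ-≤ b (*-mono-≤ {1} {3} (s≤s z≤n) 1≤a))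
  1≤3ab : 1 ≤ 3 * a * b
  1≤3ab = ≤-trans 1≤b b≤3ab

minimal-lift : ∀ {m} t p → ReducedSolution m t → MinimalTriple m (lift (t , p))
minimal-lift (x , y , z) first ((1≤x , x<y , y<z) , eq) =
  minimal-shift (≤-trans 1≤x (<⇒≤ x<y)) (<⇒≤ y<z) (trans (sym (markoff⁺-rotate x y z)) eq)
minimal-lift (x , y , z) second ((1≤x , x<y , y<z) , eq) =
  minimal-shift 1≤x (<⇒≤ (<-trans x<y y<z)) (trans (sym (markoff⁺-swap x y z)) eq)
minimal-lift (x , y , z) third ((1≤x , x<y , _) , eq) =
  minimal-shift 1≤x (<⇒≤ x<y) eq

minimal-unshift : ∀ {m a b c} → MinimalTriple m (a , b , c) → markoff⁺ a b (c ∸ 3 * a * b) ≡ m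
minimal-unshift {m} {a} {b} {c} ((_ , _ , _ , eq) , _ , _ , 3ab≤c) =
  Equivalence.from (markoff⁺⇔markoff m a b (c ∸ 3 * a * b))
    (subst (λ c → a * a + b * b + c * c ≡ 3 * a * b * c + m) (sym (m∸n+n≡m 3ab≤c)) eq)

lift-sorted : ∀ {m a b k} → 1 ≤ a → a < b → 1 ≤ k → k ≢ a → k ≢ b → markoff⁺ a b k ≡ m →
  Σ (Triple × Position) λ e → ReducedSolution m (proj₁ e) × lift e ≡ (a , b , k + 3 * a * b)
lift-sorted {a = a} {b} {k} 1≤a a<b 1≤k k≢a k≢b eq with <-cmp k a | <-cmp k b
... | tri< k<a _ _ | _ = ((k , a , b) , first) , ((1≤k , k<a , a<b) , trans (markoff⁺-rotate k a b) eq) , refl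
... | tri≈ _ k≡a _ | _ = ⊥-elim (k≢a k≡a)
... | tri> _ _ a<k | tri< k<b _ _ =
  ((a , k , b) , second) , ((1≤a , a<k , k<b) , trans (sym (markoff⁺-swap a b k)) eq) , refl
... | tri> _ _ _ | tri≈ _ k≡b _ = ⊥-elim (k≢b k≡b)
... | tri> _ _ _ | tri> _ _ b<k = ((a , b , k) , third) , ((1≤a , a<b , b<k) , eq) , refl

minimal-descent : ∀ {m t} → Prime (9 * m ∸ 4) → ¬ SumOfTwoSquares m → MinimalTriple m t →
  Σ (Triple × Position) λ e → ReducedSolution m (proj₁ e) × lift e ≡ t
minimal-descent {m} {a , b , c} p ¬sos min@((1≤a , 1≤b , _ , _) , a≤b , _ , 3ab≤c) =
  let e , sol , lift≡ = lift-sorted 1≤a a<b 1≤k k≢a k≢b eq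
  in  e , sol , trans lift≡ (cong (λ c → a , b , c) (m∸n+n≡m 3ab≤c))
  where
  k = c ∸ 3 * a * b
  eq : markoff⁺ a b k ≡ m
  eq = minimal-unshift min
  1≤k : 1 ≤ k
  1≤k = n≢0⇒n>0 λ k≡0 → markoff⁺-zero-≢ {a = a} {b} ¬sos k≡0 eq
  a<b : a < b
  a<b = ≤∧≢⇒< a≤b λ a≡b → markoff⁺-repeated-≢ p 1≤a 1≤k a≡b eq
  k≢a : k ≢ a
  k≢a k≡a = markoff⁺-repeated-≢ p 1≤k 1≤b k≡a (trans (markoff⁺-rotate k a b) eq)
  k≢b : k ≢ b
  k≢b k≡b = markoff⁺-repeated-≢ p 1≤b 1≤a (sym k≡b) (trans (sym (markoff⁺-rotate a b k)) eq)

cube : ℕ → List Triple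
cube n = cartesianProduct (upTo n) (cartesianProduct (upTo n) (upTo n))

reducedSolutions : ℕ → List Triple
reducedSolutions m = filter (reducedSolution? m) (cube (suc m))

reducedSolutions-unique : ∀ m → Unique (reducedSolutions m)
reducedSolutions-unique m = Unique.filter⁺ (reducedSolution? m) {xs = cube (suc m)}
  (Unique.cartesianProduct⁺ {xs = upTo (suc m)} (Unique.upTo⁺ (suc m))
    (Unique.cartesianProduct⁺ {xs = upTo (suc m)} (Unique.upTo⁺ (suc m)) (Unique.upTo⁺ (suc m))))

∈-reducedSolutions⁺ : ∀ {m t} → ReducedSolution m t → t ∈ reducedSolutions m
∈-reducedSolutions⁺ {m} {x , y , z} sol@(_ , refl) = ∈-filter⁺ (reducedSolution? m) in-cube sol
  where
  bounded : ∀ {u} → u ≤ markoff⁺ x y z → u ∈ upTo (suc m)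
  bounded u≤m = ∈-upTo⁺ (s≤s u≤m)
  in-cube : (x , y , z) ∈ cube (suc m)
  in-cube = ∈-cartesianProduct⁺ (bounded (n≤markoff⁺ x y z)) (∈-cartesianProduct⁺
    (bounded (subst (y ≤_) (sym (markoff⁺-rotate x y z)) (n≤markoff⁺ y z x)))
    (bounded (subst (z ≤_) (markoff⁺-rotate z x y) (n≤markoff⁺ z x y))))

∈-reducedSolutions⁻ : ∀ {m t} → t ∈ reducedSolutions m → ReducedSolution m t
∈-reducedSolutions⁻ {m} t∈ = proj₂ (∈-filter⁻ (reducedSolution? m) {xs = cube (suc m)} t∈)

liftings : ℕ → List (Triple × Position)
liftings m = cartesianProduct (reducedSolutions m) positions

∈-liftings⁻ : ∀ {m t p} → (t , p) ∈ liftings m → ReducedSolution m t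
∈-liftings⁻ {m} e∈ = ∈-reducedSolutions⁻ (proj₁ (∈-cartesianProduct⁻ (reducedSolutions m) positions e∈))

minimalTriples : ℕ → List Triple
minimalTriples m = map lift (liftings m)

minimalTriples-unique : ∀ m → Unique (minimalTriples m)
minimalTriples-unique m = unique-map-retraction descend
  (All.tabulate λ { {t , p} e∈ → descend-lift t p (proj₁ (∈-liftings⁻ {m} e∈)) })
  (Unique.cartesianProduct⁺ {xs = reducedSolutions m} (reducedSolutions-unique m) positions-unique)

∈-minimalTriples⇔ : ∀ {m} → Prime (9 * m ∸ 4) → ¬ SumOfTwoSquares m →
  ∀ t → (t ∈ minimalTriples m) ⇔ MinimalTriple m t
∈-minimalTriples⇔ {m} p ¬sos t = mk⇔ sound complete
  where
  sound : t ∈ minimalTriples m → MinimalTriple m t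
  sound t∈ with ∈-map⁻ lift t∈
  ... | (d , q) , e∈ , refl = minimal-lift d q (∈-liftings⁻ e∈)
  complete : MinimalTriple m t → t ∈ minimalTriples m
  complete min =
    let (d , q) , sol , lift≡ = minimal-descent p ¬sos min
    in  subst (_∈ minimalTriples m) lift≡
          (∈-map⁺ lift (∈-cartesianProduct⁺ (∈-reducedSolutions⁺ sol) (∈-positions q)))

length-minimalTriples : ∀ m → length (minimalTriples m) ≡ length (reducedSolutions m) * 3
length-minimalTriples m =
  trans (length-map lift (liftings m)) (length-cartesianProduct (reducedSolutions m) positions)

proposition5p2 : (m : ℕ) → 1 ≤ m → Prime (9 * m ∸ 4) → ¬ SumOfTwoSquares m →
    Σ (List (ℕ × ℕ × ℕ)) λ L →
      Unique L × (∀ t → (t ∈ L) ⇔ MinimalTriple m t) × (3 ∣ length L)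
proposition5p2 m _ p ¬sos =
  minimalTriples m ,
  minimalTriples-unique m ,
  ∈-minimalTriples⇔ p ¬sos ,
  divides (length (reducedSolutions m)) (length-minimalTriples m)
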